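{- If $G$ is a cubic graph that has a self-identifying code, then every vertex of $G$ lies in at most one triangle.
   Context: All graphs are finite, simple, undirected and connected; a cubic graph is 3-regular. $N[v] = N(v) \cup \{v\}$; $N_S[v] = N[v] \cap S$. A set $S \subseteq V(G)$ is a self-identifying code (SIC) if for every $x \in V(G)$, $N_S[x] \neq \varnothing$ and $\bigcap_{v \in N_S[x]} N[v] = \{x\}$. -}

module Defs where

open import Data.Nat using (ℕ; suc)
open import Data.Fin using (Fin)
open import Data.Bool using (Bool; true; false)
open import Data.List using (List; []; _∷_; length; filterᵇ)
open import Data.List using (allFin)
open import Data.Product using (Σ; _×_; ∃)
open import Data.Sum using (_⊎_)
open import Relation.Binary.PropositionalEquality using (_≡_; _≢_)
open import Relation.Nullary using (¬_)

record Graph (n : ℕ) : Set where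
  field
    adj       : Fin n → Fin n → Bool
    irrefl    : ∀ v → adj v v ≡ false
    symmetric : ∀ u v → adj u v ≡ adj v u
open Graph public

Adj : ∀ {n} → Graph n → Fin n → Fin n → Set
Adj G u v = adj G u v ≡ true

data Walk {n : ℕ} (G : Graph n) : Fin n → Fin n → Set where
  here : ∀ {u} → Walk G u u
  step : ∀ {u w v} → Adj G u w → Walk G w v → Walk G u v

Connected : ∀ {n} → Graph n → Set
Connected G = ∀ u v → Walk G u v

degree : ∀ {n} → Graph n → Fin n → ℕ
degree {n} G v = length (filterᵇ (adj G v) (allFin n))

Cubic : ∀ {n} → Graph n → Set
Cubic G = ∀ v → degree G v ≡ 3

_∈N[_]⟨_⟩ : ∀ {n} → Fin n → Fin n → Graph n → Set
y ∈N[ x ]⟨ G ⟩ = (y ≡ x) ⊎ Adj G x y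

Subset : ℕ → Set
Subset n = Fin n → Bool

_∈S_ : ∀ {n} → Fin n → Subset n → Set
v ∈S S = S v ≡ true

-- S is a self-identifying code of G:
-- for every x, N_S[x] = N[x] ∩ S is nonempty, and
-- ⋂_{v ∈ N_S[x]} N[v] = {x}  (equality of vertex sets).
IsSIC : ∀ {n} → Graph n → Subset n → Set
IsSIC {n} G S = ∀ (x : Fin n) →
    (∃ λ v → v ∈S S × v ∈N[ x ]⟨ G ⟩)
  × (∀ (y : Fin n) →
       ((∀ (v : Fin n) → v ∈S S → v ∈N[ x ]⟨ G ⟩ → y ∈N[ v ]⟨ G ⟩) → y ≡ x)
     × (y ≡ x → ∀ (v : Fin n) → v ∈S S → v ∈N[ x ]⟨ G ⟩ → y ∈N[ v ]⟨ G ⟩))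

HasSIC : ∀ {n} → Graph n → Set
HasSIC {n} G = ∃ λ (S : Subset n) → IsSIC G S

Triangle : ∀ {n} → Graph n → Fin n → Fin n → Fin n → Set
Triangle G v u w = Adj G v u × Adj G v w × Adj G u w

AtMostOneTriangle : ∀ {n} → Graph n → Fin n → Set
AtMostOneTriangle G v = ∀ u w u' w' →
  Triangle G v u w → Triangle G v u' w' →
  (u ≡ u' × w ≡ w') ⊎ (u ≡ w' × w ≡ u')

-- Two distinct triangles through a vertex v of a cubic graph either share an
-- edge vb, or use four distinct neighbours of v, which the degree forbids.
-- In the first case the three neighbours of v are b and its two triangle
-- partners, so N[v] ⊆ N[b]; then b lies in the intersection of the closed
-- neighbourhoods of N_S[v] for every code S, so no SIC can separate v from b.
module Submission where

open import Defs
open import Data.Nat as ℕ using (ℕ; s≤s)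
open import Data.Nat.Properties using (n<1+n)
open import Data.Fin using (Fin; zero; suc; _<_)
open import Data.Fin.Properties using (_≟_; pigeonhole)
open import Data.Bool.Properties using (T-≡)
open import Data.List using (List; filterᵇ; allFin; lookup)
open import Data.List.Membership.Propositional using (_∈_)
open import Data.List.Membership.Propositional.Properties using (∈-allFin; ∈-filter⁺)
open import Data.List.Relation.Unary.Any using (index)
open import Data.List.Relation.Unary.Any.Properties using (lookup-index)
open import Data.Product using (_×_; _,_; ∃₂; proj₁; proj₂)
open import Data.Sum using (_⊎_; inj₁; inj₂)
open import Data.Empty using (⊥; ⊥-elim)
open import Function using (_∘_)
open import Function.Bundles using (Equivalence)
open import Relation.Nullary using (yes; no)
open import Relation.Nullary.Decidable using (T?)
open import Relation.Binary.PropositionalEquality using (_≡_; _≢_; refl; sym; trans; cong; subst)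
open Relation.Binary.PropositionalEquality.≡-Reasoning

module _ {n : ℕ} (G : Graph n) where

  Adj-sym : ∀ {u v} → Adj G u v → Adj G v u
  Adj-sym {u} {v} uv = trans (symmetric G v u) uv

  Adj⇒≢ : ∀ {u v} → Adj G u v → u ≢ v
  Adj⇒≢ {u} uu refl with trans (sym uu) (irrefl G u)
  ... | ()

  triangle-swap : ∀ {v u w} → Triangle G v u w → Triangle G v w u
  triangle-swap (vu , vw , uw) = vw , vu , Adj-sym uw

  neighbours : Fin n → List (Fin n)
  neighbours v = filterᵇ (adj G v) (allFin n)

  ∈-neighbours : ∀ {v u} → Adj G v u → u ∈ neighbours v
  ∈-neighbours {v} {u} vu =
    ∈-filter⁺ (T? ∘ adj G v) (∈-allFin u) (Equivalence.from T-≡ vu)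

  -- degree G v is by definition the length of neighbours v, so indices into
  -- that list are elements of Fin (degree G v).
  degree-pigeonhole : ∀ {m v} → degree G v ℕ.< m →
    (f : Fin m → Fin n) → (∀ i → Adj G v (f i)) → ∃₂ λ i j → i < j × f i ≡ f j
  degree-pigeonhole {v = v} deg<m f adj-f
    with i , j , i<j , same-index ← pigeonhole deg<m (index ∘ ∈-neighbours ∘ adj-f)
    = i , j , i<j , (begin
        f i                                                    ≡⟨ lookup-index (∈-neighbours (adj-f i)) ⟩
        lookup (neighbours v) (index (∈-neighbours (adj-f i))) ≡⟨ cong (lookup (neighbours v)) same-index ⟩
        lookup (neighbours v) (index (∈-neighbours (adj-f j))) ≡⟨ sym (lookup-index (∈-neighbours (adj-f j))) ⟩
        f j ∎)

  IsSIC-dominator⇒≡ : ∀ {S u v} → IsSIC G S →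
    (∀ s → s ∈N[ v ]⟨ G ⟩ → u ∈N[ s ]⟨ G ⟩) → u ≡ v
  IsSIC-dominator⇒≡ {v = v} sic dominates =
    proj₁ (proj₂ (sic v) _) (λ s _ → dominates s)

module _ {n : ℕ} (G : Graph n) (cubic : Cubic G) where

  cubic-neighbour-cases : ∀ {v a b c d} →
    Adj G v a → Adj G v b → Adj G v c → Adj G v d →
    a ≢ b → a ≢ c → b ≢ c → d ≡ a ⊎ d ≡ b ⊎ d ≡ c
  cubic-neighbour-cases {v} {a} {b} {c} {d} va vb vc vd a≢b a≢c b≢c
    with degree-pigeonhole G (subst (ℕ._< 4) (sym (cubic v)) (n<1+n 3)) candidates adj-candidates
    where
    candidates : Fin 4 → Fin n
    candidates zero                   = a
    candidates (suc zero)             = b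
    candidates (suc (suc zero))       = c
    candidates (suc (suc (suc zero))) = d
    adj-candidates : ∀ i → Adj G v (candidates i)
    adj-candidates zero                   = va
    adj-candidates (suc zero)             = vb
    adj-candidates (suc (suc zero))       = vc
    adj-candidates (suc (suc (suc zero))) = vd
  ... | zero , suc zero , _ , a≡b = ⊥-elim (a≢b a≡b)
  ... | zero , suc (suc zero) , _ , a≡c = ⊥-elim (a≢c a≡c)
  ... | suc zero , suc (suc zero) , _ , b≡c = ⊥-elim (b≢c b≡c)
  ... | zero , suc (suc (suc zero)) , _ , a≡d = inj₁ (sym a≡d)
  ... | suc zero , suc (suc (suc zero)) , _ , b≡d = inj₂ (inj₁ (sym b≡d))
  ... | suc (suc zero) , suc (suc (suc zero)) , _ , c≡d = inj₂ (inj₂ (sym c≡d))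
  ... | suc zero , suc zero , s≤s () , _
  ... | suc (suc _) , suc zero , s≤s () , _
  ... | suc (suc _) , suc (suc zero) , s≤s (s≤s ()) , _
  ... | suc (suc (suc _)) , suc (suc (suc zero)) , s≤s (s≤s (s≤s ())) , _

  -- Two triangles v b a and v b c sharing the edge vb: then N[v] = {v, a, b, c} ⊆ N[b].
  no-diamond : HasSIC G → ∀ {v a b c} →
    Adj G v a → Adj G v b → Adj G v c → Adj G b a → Adj G b c → a ≢ c → ⊥
  no-diamond (_ , sic) {v} {a} {b} {c} va vb vc ba bc a≢c =
    Adj⇒≢ G vb (sym (IsSIC-dominator⇒≡ G sic b-dominates))
    where
    b-dominates : ∀ s → s ∈N[ v ]⟨ G ⟩ → b ∈N[ s ]⟨ G ⟩
    b-dominates s (inj₁ refl) = inj₂ vb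
    b-dominates s (inj₂ vs)
      with cubic-neighbour-cases va vb vc vs (Adj⇒≢ G (Adj-sym G ba)) a≢c (Adj⇒≢ G bc)
    ... | inj₁ refl        = inj₂ (Adj-sym G ba)
    ... | inj₂ (inj₁ refl) = inj₁ refl
    ... | inj₂ (inj₂ refl) = inj₂ (Adj-sym G bc)

  triangle-vertex-cases : HasSIC G → ∀ {v u w u' w'} →
    Triangle G v u w → Triangle G v u' w' → u' ≡ u ⊎ u' ≡ w
  triangle-vertex-cases hasSIC {u = u} {w} {u'} (vu , vw , uw) (vu' , vw' , u'w')
    with u' ≟ u | u' ≟ w
  ... | yes u'≡u | _        = inj₁ u'≡u
  ... | no _     | yes u'≡w = inj₂ u'≡w
  ... | no u'≢u  | no u'≢w
    with cubic-neighbour-cases vu vw vu' vw' (Adj⇒≢ G uw) (u'≢u ∘ sym) (u'≢w ∘ sym)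
  ... | inj₁ refl        = ⊥-elim (no-diamond hasSIC vw vu vu' uw (Adj-sym G u'w') (u'≢w ∘ sym))
  ... | inj₂ (inj₁ refl) = ⊥-elim (no-diamond hasSIC vu vw vu' (Adj-sym G uw) (Adj-sym G u'w') (u'≢u ∘ sym))
  ... | inj₂ (inj₂ refl) = ⊥-elim (Adj⇒≢ G u'w' refl)

mainTheorem10 : ∀ (n : ℕ) (G : Graph n) → Connected G → Cubic G →
    HasSIC G → ∀ (v : Fin n) → AtMostOneTriangle G v
mainTheorem10 n G _ cubic hasSIC v u w u' w' t t'
  with triangle-vertex-cases G cubic hasSIC t t'
     | triangle-vertex-cases G cubic hasSIC t (triangle-swap G t')
... | inj₁ u'≡u | inj₂ w'≡w = inj₁ (sym u'≡u , sym w'≡w)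
... | inj₂ u'≡w | inj₁ w'≡u = inj₂ (sym w'≡u , sym u'≡w)
... | inj₁ refl | inj₁ refl = ⊥-elim (Adj⇒≢ G (proj₂ (proj₂ t')) refl)
... | inj₂ refl | inj₂ refl = ⊥-elim (Adj⇒≢ G (proj₂ (proj₂ t')) refl)
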